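{- Let $G$ be a graph with $n$ vertices and layered treewidth $c\ge1$. Then $G$ has a set $S$ of at most $\sqrt{cn}$ vertices such that $\operatorname{tw}(G[S])\le c-1$ and $G-S$ has a tree-decomposition of width at most $\sqrt{cn}$ in which, for every $k\ge1$, the subgraph induced by the union of any $k$ bags has pathwidth at most $2ck-1$.
   Context: A layering of $G$ is an ordered partition $(V_1,\dots,V_m)$ of $V(G)$ into (possibly empty) sets such that every edge has both endpoints in $V_i\cup V_{i+1}$ for some $i$. The layered treewidth of $G$ is the minimum $\ell\ge0$ such that $G$ has a tree-decomposition $(X_x:x\in V(T))$ and a layering $(V_1,\dots,V_m)$ with $|X_x\cap V_i|\le\ell$ for every bag $X_x$ and layer $V_i$. $\operatorname{tw}$ denotes treewidth. -}

module Defs where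

open import Data.Nat using (ℕ; zero; suc; _≤_; _*_; _∸_)
open import Data.Nat.Properties using (_≟_)
open import Data.Fin using (Fin; toℕ; suc)
open import Data.Fin.Subset using (Subset; _∈_; _∩_; ∁; ⋃; ∣_∣)
import Data.Fin.Subset as Sub
open import Data.Vec using (tabulate)
import Data.List as List
open import Data.Bool using (Bool)
open import Data.Product using (Σ; ∃; _×_)
open import Data.Sum using (_⊎_)
open import Relation.Nullary using (¬_; does)
open import Relation.Binary.PropositionalEquality using (_≡_)
open import Function.Definitions using (Injective)

record Graph (n : ℕ) : Set₁ where
  field
    Adj    : Fin n → Fin n → Set
    sym    : ∀ {u v} → Adj u v → Adj v u
    irrefl : ∀ {v} → ¬ Adj v v
open Graph public

-- A (finite, nonempty) tree on nodes Fin (suc m), given by a parent array: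
-- node (suc i) has parent (parent i), whose index is ≤ i.
record Tree : Set where
  field
    m       : ℕ
    parent  : Fin m → Fin (suc m)
    parent≤ : ∀ i → toℕ (parent i) ≤ toℕ i

  Node : Set
  Node = Fin (suc m)

  TAdj : Node → Node → Set
  TAdj x y = (∃ λ i → x ≡ suc i × y ≡ parent i) ⊎ (∃ λ i → y ≡ suc i × x ≡ parent i)
open Tree public

-- The tree is a path 0 - 1 - 2 - ... - m.
IsPath : Tree → Set
IsPath T = ∀ i → toℕ (parent T i) ≡ toℕ i

data Walk {A : Set} (P : A → Set) (R : A → A → Set) : A → A → Set where
  here : ∀ {x} → P x → Walk P R x x
  step : ∀ {x y z} → P x → R x y → Walk P R y z → Walk P R x z

Connected : {A : Set} → (A → Set) → (A → A → Set) → Set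
Connected {A} P R = ∀ (x y : A) → P x → P y → Walk P R x y

record TreeDecomp {n : ℕ} (G : Graph n) (U : Subset n) : Set₁ where
  field
    tree   : Tree
    bag    : Node tree → Subset n
    bag⊆U  : ∀ x v → v ∈ bag x → v ∈ U
    vertex : ∀ v → v ∈ U → ∃ λ x → v ∈ bag x
    edge   : ∀ u v → u ∈ U → v ∈ U → Adj G u v → ∃ λ x → (u ∈ bag x × v ∈ bag x)
    conn   : ∀ v → Connected (λ x → v ∈ bag x) (TAdj tree)
open TreeDecomp public

-- Every bag has at most b vertices (i.e. width ≤ b - 1).
BagsAtMost : {n : ℕ} {G : Graph n} {U : Subset n} → TreeDecomp G U → ℕ → Set
BagsAtMost D b = ∀ x → ∣ bag D x ∣ ≤ b

TwAtMost : {n : ℕ} → Graph n → Subset n → ℕ → Set₁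
TwAtMost G U w = Σ (TreeDecomp G U) λ D → BagsAtMost D (suc w)

PwAtMost : {n : ℕ} → Graph n → Subset n → ℕ → Set₁
PwAtMost G U w = Σ (TreeDecomp G U) λ D → IsPath (tree D) × BagsAtMost D (suc w)

layerSet : {n : ℕ} → (Fin n → ℕ) → ℕ → Subset n
layerSet layer i = tabulate (λ v → does (layer v ≟ i))

IsLayering : {n : ℕ} → Graph n → (Fin n → ℕ) → Set
IsLayering G layer = ∀ u v → Adj G u v → (layer u ≤ suc (layer v) × layer v ≤ suc (layer u))

LtwAtMost : {n : ℕ} → Graph n → ℕ → Set₁
LtwAtMost {n} G ℓ =
  Σ (TreeDecomp G Sub.⊤) λ D → Σ (Fin n → ℕ) λ layer →
    IsLayering G layer × (∀ x i → ∣ bag D x ∩ layerSet layer i ∣ ≤ ℓ)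

LayeredTreewidth : {n : ℕ} → Graph n → ℕ → Set₁
LayeredTreewidth G c = LtwAtMost G c × (∀ ℓ → LtwAtMost G ℓ → c ≤ ℓ)

unionBags : {n : ℕ} {G : Graph n} {U : Subset n} (D : TreeDecomp G U) {k : ℕ} →
            (Fin k → Node (tree D)) → Subset n
unionBags D f = ⋃ (List.tabulate (λ j → bag D (f j)))

{-# OPTIONS --safe #-}
module Submission where

-- Fix a layered tree-decomposition of width c and a period σ ≥ 2 with n ≤ cσ², σ least.
-- Shifting the layering by some t < σ makes the set S of vertices whose layer is a multiple
-- of σ satisfy σ|S| ≤ n (pigeonhole over the σ disjoint choices), so |S|² ≤ cn. No edge of
-- G[S] joins two layers, and no edge of G − S leaves a block of σ − 1 consecutive layers
-- between two multiples. Parts of a vertex set with no edges between them can be decomposed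
-- separately and their trees hung together; so cutting every bag into its layers (for G[S])
-- or into its blocks (for G − S) gives decompositions with bags of at most c, respectively
-- min(n, (σ − 1)c) ≤ √(cn), vertices, each inside an original bag. Hence k bags of the latter meet
-- every layer in at most kc vertices, and taking two consecutive layers of their union at a
-- time is a path decomposition of width 2kc − 1.

open import Defs hiding (sym)
import Defs
open import Data.Nat using (ℕ; zero; suc; _+_; _*_; _∸_; _⊓_; _≤_; _<_; _≤?_; s≤s; s≤s⁻¹; z≤n; NonZero; >-nonZero)
open import Data.Nat.Properties
open import Data.Nat.DivMod using (_/_; _%_; m≡m%n+[m/n]*n; m%n<n; m/n*n≤m; m*n/n≡m; /-monoˡ-≤; m<n*o⇒m/o<n)
open import Data.Nat.Divisibility using (_∣_; _∣?_; divides; ∣m+n∣m⇒∣n; >⇒∤)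
open import Data.Fin using (Fin; zero; suc; toℕ; _↑ˡ_; _↑ʳ_; splitAt; inject₁; fromℕ<)
open import Data.Fin.Properties using (toℕ-↑ˡ; toℕ-↑ʳ; splitAt-↑ˡ; splitAt-↑ʳ; splitAt⁻¹-↑ˡ; splitAt⁻¹-↑ʳ; toℕ-inject₁; toℕ-fromℕ<; toℕ-injective)
open import Data.Fin.Subset using (Subset; _∈_; _⊆_; _∩_; _∪_; ∁; ⋃; ∣_∣; Empty)
import Data.Fin.Subset as Subset
open import Data.Fin.Subset.Properties
open import Data.Vec using (_∷_; []; tabulate)
open import Data.Vec.Properties using (lookup∘tabulate; []=⇒lookup; lookup⇒[]=)
open import Data.Bool using (true; false)
import Data.List as List
open import Data.Sum using (_⊎_; inj₁; inj₂; [_,_]′)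
open import Data.Product using (Σ; ∃; ∃₂; _×_; _,_; proj₁; proj₂)
open import Data.Empty using (⊥-elim)
open import Function using (_∘_; case_of_)
open import Relation.Nullary using (¬_; does; yes; no; contradiction)
open import Relation.Nullary.Decidable using (dec-true)
open import Relation.Unary using (Decidable)
open import Data.Nat.Tactic.RingSolver using (solve-∀)
open import Relation.Binary.Definitions using (tri<; tri≈; tri>)
open import Function.Definitions using (Injective)
open import Relation.Binary.PropositionalEquality

select : ∀ {n} {P : Fin n → Set} → Decidable P → Subset n
select P? = tabulate (does ∘ P?)

module _ {n} {P : Fin n → Set} (P? : Decidable P) where

  ∈-select⁺ : ∀ {v} → P v → v ∈ select P?
  ∈-select⁺ {v} pv = lookup⇒[]= v _ (trans (lookup∘tabulate _ v) (dec-true (P? v) pv))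

  ∈-select⁻ : ∀ {v} → v ∈ select P? → P v
  ∈-select⁻ {v} v∈ with P? v | trans (sym (lookup∘tabulate (does ∘ P?) v)) ([]=⇒lookup v∈)
  ... | yes pv | _ = pv
  ... | no _  | ()

∈-layerSet⁺ : ∀ {n} {ℓ : Fin n → ℕ} {i v} → ℓ v ≡ i → v ∈ layerSet ℓ i
∈-layerSet⁺ {ℓ = ℓ} {i} = ∈-select⁺ (λ v → ℓ v ≟ i)

∈-layerSet⁻ : ∀ {n} {ℓ : Fin n → ℕ} {i v} → v ∈ layerSet ℓ i → ℓ v ≡ i
∈-layerSet⁻ {ℓ = ℓ} {i} = ∈-select⁻ (λ v → ℓ v ≟ i)

∣p∪q∣+∣p∩q∣≡∣p∣+∣q∣ : ∀ {n} (p q : Subset n) → ∣ p ∪ q ∣ + ∣ p ∩ q ∣ ≡ ∣ p ∣ + ∣ q ∣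
∣p∪q∣+∣p∩q∣≡∣p∣+∣q∣ []            []            = refl
∣p∪q∣+∣p∩q∣≡∣p∣+∣q∣ (true  ∷ p) (true  ∷ q) =
  cong suc (trans (+-suc ∣ p ∪ q ∣ _) (trans (cong suc (∣p∪q∣+∣p∩q∣≡∣p∣+∣q∣ p q)) (sym (+-suc ∣ p ∣ _))))
∣p∪q∣+∣p∩q∣≡∣p∣+∣q∣ (true  ∷ p) (false ∷ q) = cong suc (∣p∪q∣+∣p∩q∣≡∣p∣+∣q∣ p q)
∣p∪q∣+∣p∩q∣≡∣p∣+∣q∣ (false ∷ p) (true  ∷ q) = trans (cong suc (∣p∪q∣+∣p∩q∣≡∣p∣+∣q∣ p q)) (sym (+-suc ∣ p ∣ _))
∣p∪q∣+∣p∩q∣≡∣p∣+∣q∣ (false ∷ p) (false ∷ q) = ∣p∪q∣+∣p∩q∣≡∣p∣+∣q∣ p q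

∣p∪q∣≤∣p∣+∣q∣ : ∀ {n} (p q : Subset n) → ∣ p ∪ q ∣ ≤ ∣ p ∣ + ∣ q ∣
∣p∪q∣≤∣p∣+∣q∣ p q = ≤-trans (m≤m+n _ _) (≤-reflexive (∣p∪q∣+∣p∩q∣≡∣p∣+∣q∣ p q))

Empty⇒∣p∣≡0 : ∀ {n} {p : Subset n} → Empty p → ∣ p ∣ ≡ 0
Empty⇒∣p∣≡0 {n} empty = trans (cong ∣_∣ (Empty-unique empty)) (∣⊥∣≡0 n)

Empty[p∩q]⇒∣p∣+∣q∣≤∣p∪q∣ : ∀ {n} (p q : Subset n) → Empty (p ∩ q) → ∣ p ∣ + ∣ q ∣ ≤ ∣ p ∪ q ∣
Empty[p∩q]⇒∣p∣+∣q∣≤∣p∪q∣ p q disjoint = ≤-reflexive (begin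
  ∣ p ∣ + ∣ q ∣             ≡⟨ ∣p∪q∣+∣p∩q∣≡∣p∣+∣q∣ p q ⟨
  ∣ p ∪ q ∣ + ∣ p ∩ q ∣     ≡⟨ cong (∣ p ∪ q ∣ +_) (Empty⇒∣p∣≡0 disjoint) ⟩
  ∣ p ∪ q ∣ + 0             ≡⟨ +-identityʳ _ ⟩
  ∣ p ∪ q ∣                 ∎)
  where open ≡-Reasoning

∣p∣≤∣p∩q∣+∣p∩∁q∣ : ∀ {n} (p q : Subset n) → ∣ p ∣ ≤ ∣ p ∩ q ∣ + ∣ p ∩ ∁ q ∣
∣p∣≤∣p∩q∣+∣p∩∁q∣ p q = begin
  ∣ p ∣                         ≡⟨ cong ∣_∣ (∩-identityʳ p) ⟨
  ∣ p ∩ Subset.⊤ ∣              ≡⟨ cong (λ r → ∣ p ∩ r ∣) (p∪∁p≡⊤ q) ⟨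
  ∣ p ∩ (q ∪ ∁ q) ∣             ≡⟨ cong ∣_∣ (∩-distribˡ-∪ p q (∁ q)) ⟩
  ∣ p ∩ q ∪ p ∩ ∁ q ∣           ≤⟨ ∣p∪q∣≤∣p∣+∣q∣ (p ∩ q) (p ∩ ∁ q) ⟩
  ∣ p ∩ q ∣ + ∣ p ∩ ∁ q ∣       ∎
  where open ≤-Reasoning

∣⋃∩p∣≤k*c : ∀ {n} k (f : Fin k → Subset n) (p : Subset n) {c} →
            (∀ j → ∣ f j ∩ p ∣ ≤ c) → ∣ ⋃ (List.tabulate f) ∩ p ∣ ≤ k * c
∣⋃∩p∣≤k*c {n} zero f p f≤ = ≤-trans (∣p∩q∣≤∣p∣ Subset.⊥ p) (≤-reflexive (∣⊥∣≡0 n))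
∣⋃∩p∣≤k*c (suc k) f p {c} f≤ = begin
  ∣ (f zero ∪ rest) ∩ p ∣          ≡⟨ cong ∣_∣ (∩-distribʳ-∪ p (f zero) rest) ⟩
  ∣ f zero ∩ p ∪ rest ∩ p ∣        ≤⟨ ∣p∪q∣≤∣p∣+∣q∣ (f zero ∩ p) (rest ∩ p) ⟩
  ∣ f zero ∩ p ∣ + ∣ rest ∩ p ∣    ≤⟨ +-mono-≤ (f≤ zero) (∣⋃∩p∣≤k*c k (f ∘ suc) p (f≤ ∘ suc)) ⟩
  c + k * c                        ∎
  where
  open ≤-Reasoning
  rest = ⋃ (List.tabulate (f ∘ suc))

module _ {n} (g : Fin n → ℕ) {c} {p : Subset n} (fibre≤ : ∀ i → ∣ p ∩ layerSet g i ∣ ≤ c) where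

  interval⇒∣q∣≤d*c : ∀ d a {q} → q ⊆ p → (∀ {v} → v ∈ q → a ≤ g v × g v < a + d) → ∣ q ∣ ≤ d * c
  interval⇒∣q∣≤d*c zero a _ range = ≤-reflexive (Empty⇒∣p∣≡0 λ (v , v∈q) →
    let (a≤gv , gv<a+0) = range v∈q in <-irrefl refl (≤-<-trans a≤gv (subst (g v <_) (+-identityʳ a) gv<a+0)))
  interval⇒∣q∣≤d*c (suc d) a {q} q⊆p range = begin
    ∣ q ∣                                       ≤⟨ ∣p∣≤∣p∩q∣+∣p∩∁q∣ q (layerSet g a) ⟩
    ∣ q ∩ layerSet g a ∣ + ∣ q ∩ ∁ (layerSet g a) ∣
      ≤⟨ +-mono-≤ (≤-trans (p⊆q⇒∣p∣≤∣q∣ layer-a⊆) (fibre≤ a))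
                  (interval⇒∣q∣≤d*c d (suc a) (q⊆p ∘ proj₁ ∘ x∈p∩q⁻ q _) range-above-a) ⟩
    c + d * c                                   ∎
    where
    open ≤-Reasoning
    layer-a⊆ : q ∩ layerSet g a ⊆ p ∩ layerSet g a
    layer-a⊆ v∈ = let (v∈q , v∈a) = x∈p∩q⁻ q _ v∈ in x∈p∩q⁺ (q⊆p v∈q , v∈a)
    range-above-a : ∀ {v} → v ∈ q ∩ ∁ (layerSet g a) → suc a ≤ g v × g v < suc a + d
    range-above-a {v} v∈ =
      let (v∈q , v∉a) = x∈p∩q⁻ q _ v∈ ; (a≤gv , gv<) = range v∈q in
      ≤∧≢⇒< a≤gv (λ a≡gv → x∈∁p⇒x∉p v∉a (∈-layerSet⁺ {ℓ = g} (sym a≡gv))) , subst (g v <_) (+-suc a d) gv<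

unionBelow : ∀ {n} → (ℕ → Subset n) → ℕ → Subset n
unionBelow S zero    = Subset.⊥
unionBelow S (suc d) = unionBelow S d ∪ S d

module _ {n} (S : ℕ → Subset n) where

  ∈-unionBelow⁺ : ∀ {d j v} → j < d → v ∈ S j → v ∈ unionBelow S d
  ∈-unionBelow⁺ {suc d} {j} j<1+d v∈Sj with m<1+n⇒m<n∨m≡n j<1+d
  ... | inj₁ j<d  = x∈p∪q⁺ (inj₁ (∈-unionBelow⁺ j<d v∈Sj))
  ... | inj₂ refl = x∈p∪q⁺ (inj₂ v∈Sj)

  ∈-unionBelow⁻ : ∀ d {v} → v ∈ unionBelow S d → ∃ λ j → j < d × v ∈ S j
  ∈-unionBelow⁻ zero    v∈ = contradiction v∈ ∉⊥
  ∈-unionBelow⁻ (suc d) v∈ with x∈p∪q⁻ (unionBelow S d) (S d) v∈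
  ... | inj₁ v∈below = let (j , j<d , v∈Sj) = ∈-unionBelow⁻ d v∈below in j , m<n⇒m<1+n j<d , v∈Sj
  ... | inj₂ v∈Sd    = d , ≤-refl , v∈Sd

  ∣S∣+∣unionBelow∣≤∣unionBelow-suc∣ : ∀ d → (∀ {j} → j < d → Empty (S j ∩ S d)) →
                                  ∣ S d ∣ + ∣ unionBelow S d ∣ ≤ ∣ unionBelow S (suc d) ∣
  ∣S∣+∣unionBelow∣≤∣unionBelow-suc∣ d disjoint =
    ≤-trans (≤-reflexive (+-comm ∣ S d ∣ _)) (Empty[p∩q]⇒∣p∣+∣q∣≤∣p∪q∣ _ _ λ (v , v∈) →
      let (v∈below , v∈Sd) = x∈p∩q⁻ (unionBelow S d) (S d) v∈
          (j , j<d , v∈Sj) = ∈-unionBelow⁻ d v∈below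
      in disjoint j<d (v , x∈p∩q⁺ (v∈Sj , v∈Sd)))

  pigeonhole : ∀ d → (∀ {i j} → i < j → j ≤ d → Empty (S i ∩ S j)) →
               ∃ λ t → t ≤ d × suc d * ∣ S t ∣ ≤ ∣ unionBelow S (suc d) ∣
  pigeonhole zero _ = 0 , ≤-refl , ≤-reflexive (trans (+-identityʳ _) (cong ∣_∣ (sym (∪-identityˡ (S 0)))))
  pigeonhole (suc d) disjoint with pigeonhole d (λ i<j j≤d → disjoint i<j (m≤n⇒m≤1+n j≤d))
  ... | t , t≤d , bound with ∣ S t ∣ ≤? ∣ S (suc d) ∣
  ... | yes St≤ = t , m≤n⇒m≤1+n t≤d ,
        ≤-trans (+-mono-≤ St≤ bound) (∣S∣+∣unionBelow∣≤∣unionBelow-suc∣ (suc d) (λ j<1+d → disjoint j<1+d ≤-refl))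
  ... | no St≰  = suc d , ≤-refl ,
        ≤-trans (+-monoʳ-≤ _ (≤-trans (*-monoʳ-≤ (suc d) (<⇒≤ (≰⇒> St≰))) bound))
                (∣S∣+∣unionBelow∣≤∣unionBelow-suc∣ (suc d) (λ j<1+d → disjoint j<1+d ≤-refl))

module _ {σ} .{{_ : NonZero σ}} where

  /-unique : ∀ {a} j → j * σ ≤ a → a < suc j * σ → a / σ ≡ j
  /-unique {a} j jσ≤a a<[1+j]σ = ≤-antisym (s≤s⁻¹ (m<n*o⇒m/o<n a<[1+j]σ)) (begin
    j              ≡⟨ m*n/n≡m j σ ⟨
    j * σ / σ      ≤⟨ /-monoˡ-≤ σ jσ≤a ⟩
    a / σ          ∎)
    where open ≤-Reasoning

  m<[1+m/n]*n : ∀ a → a < suc (a / σ) * σ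
  m<[1+m/n]*n a = begin-strict
    a                      ≡⟨ m≡m%n+[m/n]*n a σ ⟩
    a % σ + (a / σ) * σ    <⟨ +-monoˡ-< ((a / σ) * σ) (m%n<n a σ) ⟩
    σ + (a / σ) * σ        ∎
    where open ≤-Reasoning

  ∤⇒[m/n]*n<m : ∀ {a} → ¬ σ ∣ a → (a / σ) * σ < a
  ∤⇒[m/n]*n<m {a} σ∤a = ≤∧≢⇒< (m/n*n≤m a σ) (λ eq → σ∤a (divides (a / σ) (sym eq)))

  ∤[1+m]⇒[1+m]/n≡m/n : ∀ {a} → ¬ σ ∣ suc a → suc a / σ ≡ a / σ
  ∤[1+m]⇒[1+m]/n≡m/n {a} σ∤1+a = /-unique (a / σ) (≤-trans (m/n*n≤m a σ) (n≤1+n a))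
    (≤∧≢⇒< (m<[1+m/n]*n a) (λ eq → σ∤1+a (divides (suc (a / σ)) eq)))

∣m⇒∤[1+m] : ∀ {σ a} → 1 < σ → σ ∣ a → ¬ σ ∣ suc a
∣m⇒∤[1+m] {σ} {a} 1<σ σ∣a σ∣1+a = >⇒∤ 1<σ (∣m+n∣m⇒∣n (subst (σ ∣_) (+-comm 1 a) σ∣1+a) σ∣a)

∣m+t₁⇒∤m+t₂ : ∀ {σ m t₁ t₂} → t₁ < t₂ → t₂ < σ → σ ∣ m + t₁ → ¬ σ ∣ m + t₂
∣m+t₁⇒∤m+t₂ {σ} {m} {t₁} {t₂} t₁<t₂ t₂<σ σ∣m+t₁ σ∣m+t₂ =
  >⇒∤ {{>-nonZero (m<n⇒0<n∸m t₁<t₂)}} (≤-<-trans (m∸n≤m t₂ t₁) t₂<σ)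
      (∣m+n∣m⇒∣n (subst (σ ∣_) m+t₂≡m+t₁+[t₂∸t₁] σ∣m+t₂) σ∣m+t₁)
  where
  m+t₂≡m+t₁+[t₂∸t₁] : m + t₂ ≡ m + t₁ + (t₂ ∸ t₁)
  m+t₂≡m+t₁+[t₂∸t₁] = trans (cong (m +_) (sym (m+[n∸m]≡n (<⇒≤ t₁<t₂)))) (sym (+-assoc m t₁ _))

multiples : ∀ {n} → ℕ → (Fin n → ℕ) → Subset n
multiples σ f = select (λ v → σ ∣? f v)

∈-multiples⁺ : ∀ {n σ} {f : Fin n → ℕ} {v} → σ ∣ f v → v ∈ multiples σ f
∈-multiples⁺ {σ = σ} {f} = ∈-select⁺ (λ v → σ ∣? f v)

∈-multiples⁻ : ∀ {n σ} {f : Fin n → ℕ} {v} → v ∈ multiples σ f → σ ∣ f v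
∈-multiples⁻ {σ = σ} {f} = ∈-select⁻ (λ v → σ ∣? f v)

sparse-shift : ∀ {n} (f : Fin n → ℕ) d → ∃ λ t → suc d * ∣ multiples (suc d) (λ v → f v + t) ∣ ≤ n
sparse-shift {n} f d =
  let (t , _ , bound) = pigeonhole S d disjoint in t , ≤-trans bound (∣p∣≤n (unionBelow S (suc d)))
  where
  S : ℕ → Subset n
  S t = multiples (suc d) (λ v → f v + t)
  disjoint : ∀ {t₁ t₂} → t₁ < t₂ → t₂ ≤ d → Empty (S t₁ ∩ S t₂)
  disjoint {t₁} {t₂} t₁<t₂ t₂≤d (v , v∈) = let (v∈₁ , v∈₂) = x∈p∩q⁻ (S t₁) (S t₂) v∈ in
    ∣m+t₁⇒∤m+t₂ t₁<t₂ (s≤s t₂≤d) (∈-multiples⁻ {f = λ v → f v + t₁} v∈₁) (∈-multiples⁻ {f = λ v → f v + t₂} v∈₂)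

mapWalk : ∀ {A B : Set} {P : A → Set} {Q : B → Set} {R : A → A → Set} {S : B → B → Set} (f : A → B) →
          (∀ {a} → P a → Q (f a)) → (∀ {a b} → R a b → S (f a) (f b)) →
          ∀ {x y} → Walk P R x y → Walk Q S (f x) (f y)
mapWalk f P⇒Q R⇒S (here px)        = here (P⇒Q px)
mapWalk f P⇒Q R⇒S (step px r walk) = step (P⇒Q px) (R⇒S r) (mapWalk f P⇒Q R⇒S walk)

bounded : ∀ {n} (f : Fin n → ℕ) → ∃ λ B → ∀ v → f v < B
bounded {zero}  f = 0 , λ ()
bounded {suc n} f =
  let (B , f<B) = bounded (f ∘ suc) in
  suc (f zero) + B , λ where
    zero    → m≤m+n (suc (f zero)) B
    (suc v) → ≤-trans (f<B v) (m≤n+m B (suc (f zero)))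

module _ {n} {G : Graph n} where

  restrict : ∀ {W U} → TreeDecomp G W → U ⊆ W → TreeDecomp G U
  restrict {U = U} D U⊆W = record
    { tree   = tree D
    ; bag    = λ x → bag D x ∩ U
    ; bag⊆U  = λ x v v∈ → proj₂ (x∈p∩q⁻ (bag D x) U v∈)
    ; vertex = λ v v∈U → let (x , v∈x) = vertex D v (U⊆W v∈U) in x , x∈p∩q⁺ (v∈x , v∈U)
    ; edge   = λ u v u∈U v∈U uv →
        let (x , u∈x , v∈x) = edge D u v (U⊆W u∈U) (U⊆W v∈U) uv in
        x , x∈p∩q⁺ (u∈x , u∈U) , x∈p∩q⁺ (v∈x , v∈U)
    ; conn   = λ v x y v∈x v∈y →
        let (v∈Dx , v∈U) = x∈p∩q⁻ (bag D x) U v∈x in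
        mapWalk (λ z → z) (λ v∈z → x∈p∩q⁺ (v∈z , v∈U)) (λ r → r)
                (conn D v x y v∈Dx (proj₁ (x∈p∩q⁻ (bag D y) U v∈y)))
    }

  emptyDecomp : TreeDecomp G Subset.⊥
  emptyDecomp = record
    { tree   = record { m = 0 ; parent = λ () ; parent≤ = λ () }
    ; bag    = λ _ → Subset.⊥
    ; bag⊆U  = λ _ _ v∈ → v∈
    ; vertex = λ _ v∈ → contradiction v∈ ∉⊥
    ; edge   = λ _ _ u∈ _ _ → contradiction u∈ ∉⊥
    ; conn   = λ _ _ _ v∈ _ → contradiction v∈ ∉⊥
    }

-- The nodes of T₁ come first, then those of T₂; the root of T₂ becomes a child of the root of T₁.
module _ (T₁ T₂ : Tree) where
  private
    m₁ = m T₁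
    m₂ = m T₂

  joinParent : Fin m₁ ⊎ Fin (suc m₂) → Fin (suc m₁ + suc m₂)
  joinParent (inj₁ i)       = parent T₁ i ↑ˡ suc m₂
  joinParent (inj₂ zero)    = zero
  joinParent (inj₂ (suc j)) = suc m₁ ↑ʳ parent T₂ j

  joinParent≤ : ∀ i → toℕ (joinParent (splitAt m₁ i)) ≤ toℕ i
  joinParent≤ i with splitAt m₁ i in split≡
  ... | inj₁ i₁ = begin
    toℕ (parent T₁ i₁ ↑ˡ suc m₂)   ≡⟨ toℕ-↑ˡ (parent T₁ i₁) (suc m₂) ⟩
    toℕ (parent T₁ i₁)             ≤⟨ parent≤ T₁ i₁ ⟩
    toℕ i₁                         ≡⟨ toℕ-↑ˡ i₁ (suc m₂) ⟨
    toℕ (i₁ ↑ˡ suc m₂)             ≡⟨ cong toℕ (splitAt⁻¹-↑ˡ split≡) ⟩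
    toℕ i                          ∎
    where open ≤-Reasoning
  ... | inj₂ zero    = z≤n
  ... | inj₂ (suc j) = begin
    toℕ (suc m₁ ↑ʳ parent T₂ j)    ≡⟨ toℕ-↑ʳ (suc m₁) (parent T₂ j) ⟩
    suc m₁ + toℕ (parent T₂ j)     ≤⟨ +-monoʳ-≤ (suc m₁) (parent≤ T₂ j) ⟩
    suc m₁ + toℕ j                 ≡⟨ +-suc m₁ (toℕ j) ⟨
    m₁ + toℕ (suc j)               ≡⟨ toℕ-↑ʳ m₁ (suc j) ⟨
    toℕ (m₁ ↑ʳ suc j)              ≡⟨ cong toℕ (splitAt⁻¹-↑ʳ split≡) ⟩
    toℕ i                          ∎
    where open ≤-Reasoning

  joinTree : Tree
  joinTree = record { m = m₁ + suc m₂ ; parent = joinParent ∘ splitAt m₁ ; parent≤ = joinParent≤ }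

  inl : Node T₁ → Node joinTree
  inl x = x ↑ˡ suc m₂

  inr : Node T₂ → Node joinTree
  inr y = suc m₁ ↑ʳ y

  inl-or-inr : ∀ z → (∃ λ x → z ≡ inl x) ⊎ (∃ λ y → z ≡ inr y)
  inl-or-inr z with splitAt (suc m₁) z in split≡
  ... | inj₁ x = inj₁ (x , sym (splitAt⁻¹-↑ˡ split≡))
  ... | inj₂ y = inj₂ (y , sym (splitAt⁻¹-↑ʳ split≡))

  inl-TAdj : ∀ {a b} → TAdj T₁ a b → TAdj joinTree (inl a) (inl b)
  inl-TAdj (inj₁ (i , refl , refl)) = inj₁ (i ↑ˡ suc m₂ , refl , sym (cong joinParent (splitAt-↑ˡ m₁ i (suc m₂))))
  inl-TAdj (inj₂ (i , refl , refl)) = inj₂ (i ↑ˡ suc m₂ , refl , sym (cong joinParent (splitAt-↑ˡ m₁ i (suc m₂))))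

  inr-TAdj : ∀ {a b} → TAdj T₂ a b → TAdj joinTree (inr a) (inr b)
  inr-TAdj (inj₁ (j , refl , refl)) = inj₁ (m₁ ↑ʳ suc j , refl , sym (cong joinParent (splitAt-↑ʳ m₁ (suc m₂) (suc j))))
  inr-TAdj (inj₂ (j , refl , refl)) = inj₂ (m₁ ↑ʳ suc j , refl , sym (cong joinParent (splitAt-↑ʳ m₁ (suc m₂) (suc j))))

module _ {n} {G : Graph n} {U₁ U₂ : Subset n} (D₁ : TreeDecomp G U₁) (D₂ : TreeDecomp G U₂)
         (disjoint : Empty (U₁ ∩ U₂)) (separated : ∀ {u v} → u ∈ U₁ → v ∈ U₂ → ¬ Adj G u v) where
  private
    T = joinTree (tree D₁) (tree D₂)
    inl₁ = inl (tree D₁) (tree D₂)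
    inr₂ = inr (tree D₁) (tree D₂)

  joinBag : Node T → Subset n
  joinBag z = [ bag D₁ , bag D₂ ]′ (splitAt (suc (m (tree D₁))) z)

  joinBag-inl : ∀ x → joinBag (inl₁ x) ≡ bag D₁ x
  joinBag-inl x = cong [ bag D₁ , bag D₂ ]′ (splitAt-↑ˡ _ x _)

  joinBag-inr : ∀ y → joinBag (inr₂ y) ≡ bag D₂ y
  joinBag-inr y = cong [ bag D₁ , bag D₂ ]′ (splitAt-↑ʳ _ _ y)

  private
    ∈-inl⁺ : ∀ {v x} → v ∈ bag D₁ x → v ∈ joinBag (inl₁ x)
    ∈-inl⁺ {v} {x} = subst (v ∈_) (sym (joinBag-inl x))
    ∈-inl⁻ : ∀ {v x} → v ∈ joinBag (inl₁ x) → v ∈ bag D₁ x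
    ∈-inl⁻ {v} {x} = subst (v ∈_) (joinBag-inl x)
    ∈-inr⁺ : ∀ {v y} → v ∈ bag D₂ y → v ∈ joinBag (inr₂ y)
    ∈-inr⁺ {v} {y} = subst (v ∈_) (sym (joinBag-inr y))
    ∈-inr⁻ : ∀ {v y} → v ∈ joinBag (inr₂ y) → v ∈ bag D₂ y
    ∈-inr⁻ {v} {y} = subst (v ∈_) (joinBag-inr y)

    joinBag⊆ : ∀ z v → v ∈ joinBag z → v ∈ U₁ ∪ U₂
    joinBag⊆ z v v∈ with inl-or-inr (tree D₁) (tree D₂) z
    ... | inj₁ (x , refl) = x∈p∪q⁺ (inj₁ (bag⊆U D₁ x v (∈-inl⁻ v∈)))
    ... | inj₂ (y , refl) = x∈p∪q⁺ (inj₂ (bag⊆U D₂ y v (∈-inr⁻ v∈)))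

    joinVertex : ∀ v → v ∈ U₁ ∪ U₂ → ∃ λ z → v ∈ joinBag z
    joinVertex v v∈ with x∈p∪q⁻ U₁ U₂ v∈
    ... | inj₁ v∈U₁ = let (x , v∈x) = vertex D₁ v v∈U₁ in inl₁ x , ∈-inl⁺ v∈x
    ... | inj₂ v∈U₂ = let (y , v∈y) = vertex D₂ v v∈U₂ in inr₂ y , ∈-inr⁺ v∈y

    joinEdge : ∀ u v → u ∈ U₁ ∪ U₂ → v ∈ U₁ ∪ U₂ → Adj G u v → ∃ λ z → u ∈ joinBag z × v ∈ joinBag z
    joinEdge u v u∈ v∈ uv with x∈p∪q⁻ U₁ U₂ u∈ | x∈p∪q⁻ U₁ U₂ v∈
    ... | inj₁ u∈U₁ | inj₁ v∈U₁ = let (x , u∈x , v∈x) = edge D₁ u v u∈U₁ v∈U₁ uv in inl₁ x , ∈-inl⁺ u∈x , ∈-inl⁺ v∈x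
    ... | inj₂ u∈U₂ | inj₂ v∈U₂ = let (y , u∈y , v∈y) = edge D₂ u v u∈U₂ v∈U₂ uv in inr₂ y , ∈-inr⁺ u∈y , ∈-inr⁺ v∈y
    ... | inj₁ u∈U₁ | inj₂ v∈U₂ = contradiction uv (separated u∈U₁ v∈U₂)
    ... | inj₂ u∈U₂ | inj₁ v∈U₁ = contradiction (Defs.sym G uv) (separated v∈U₁ u∈U₂)

    joinConn : ∀ v → Connected (λ z → v ∈ joinBag z) (TAdj T)
    joinConn v z₁ z₂ v∈z₁ v∈z₂ with inl-or-inr (tree D₁) (tree D₂) z₁ | inl-or-inr (tree D₁) (tree D₂) z₂
    ... | inj₁ (x₁ , refl) | inj₁ (x₂ , refl) =
      mapWalk inl₁ ∈-inl⁺ (inl-TAdj (tree D₁) (tree D₂)) (conn D₁ v x₁ x₂ (∈-inl⁻ v∈z₁) (∈-inl⁻ v∈z₂))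
    ... | inj₂ (y₁ , refl) | inj₂ (y₂ , refl) =
      mapWalk inr₂ ∈-inr⁺ (inr-TAdj (tree D₁) (tree D₂)) (conn D₂ v y₁ y₂ (∈-inr⁻ v∈z₁) (∈-inr⁻ v∈z₂))
    ... | inj₁ (x , refl) | inj₂ (y , refl) =
      ⊥-elim (disjoint (v , x∈p∩q⁺ (bag⊆U D₁ x v (∈-inl⁻ v∈z₁) , bag⊆U D₂ y v (∈-inr⁻ v∈z₂))))
    ... | inj₂ (y , refl) | inj₁ (x , refl) =
      ⊥-elim (disjoint (v , x∈p∩q⁺ (bag⊆U D₁ x v (∈-inl⁻ v∈z₂) , bag⊆U D₂ y v (∈-inr⁻ v∈z₁))))

  join : TreeDecomp G (U₁ ∪ U₂)
  join = record
    { tree = T ; bag = joinBag ; bag⊆U = joinBag⊆ ; vertex = joinVertex ; edge = joinEdge ; conn = joinConn }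

  join-bags : ∀ z → (∃ λ x → bag join z ≡ bag D₁ x) ⊎ (∃ λ y → bag join z ≡ bag D₂ y)
  join-bags z with inl-or-inr (tree D₁) (tree D₂) z
  ... | inj₁ (x , refl) = inj₁ (x , joinBag-inl x)
  ... | inj₂ (y , refl) = inj₂ (y , joinBag-inr y)

module _ {n} {G : Graph n} {W : Subset n} (D : TreeDecomp G W) (β : Fin n → ℕ) where

  InBagAndFibre : Subset n → Set
  InBagAndFibre b = ∃₂ λ x j → b ⊆ bag D x ∩ layerSet β j

  FibredDecomp : Subset n → Set₁
  FibredDecomp U = Σ (TreeDecomp G U) λ D₁ → ∀ z → InBagAndFibre (bag D₁ z)

  fibredDecomp : ∀ {U} → U ⊆ W → (∀ {u v} → u ∈ U → v ∈ U → Adj G u v → β u ≡ β v) → FibredDecomp U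
  fibredDecomp {U} U⊆W β-constant = subst FibredDecomp prefix-B≡U (prefix B)
    where
    piece : ℕ → Subset n
    piece j = U ∩ layerSet β j

    piece⊆W : ∀ {j} → piece j ⊆ W
    piece⊆W = U⊆W ∘ proj₁ ∘ x∈p∩q⁻ U _

    B = proj₁ (bounded β)

    prefix-B≡U : unionBelow piece B ≡ U
    prefix-B≡U = ⊆-antisym
      (λ v∈ → let (_ , _ , v∈piece) = ∈-unionBelow⁻ piece B v∈ in proj₁ (x∈p∩q⁻ U _ v∈piece))
      (λ {v} v∈U → ∈-unionBelow⁺ piece (proj₂ (bounded β) v) (x∈p∩q⁺ (v∈U , ∈-layerSet⁺ {ℓ = β} refl)))

    prefix : ∀ J → FibredDecomp (unionBelow piece J)
    prefix zero    = emptyDecomp , λ _ → zero , 0 , λ v∈⊥ → contradiction v∈⊥ ∉⊥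
    prefix (suc J) =
      let (D₁ , fibred) = prefix J
          D₂ = restrict D (piece⊆W {J})
      in join D₁ D₂ disjoint separated , λ z → case join-bags D₁ D₂ disjoint separated z of λ where
           (inj₁ (x , bag≡)) → subst InBagAndFibre (sym bag≡) (fibred x)
           (inj₂ (y , bag≡)) → y , J , λ v∈ → let (v∈Dy , v∈piece) = x∈p∩q⁻ (bag D y) _ (subst (_ ∈_) bag≡ v∈) in
                                 x∈p∩q⁺ (v∈Dy , proj₂ (x∈p∩q⁻ U _ v∈piece))
      where
      below : ∀ {v} → v ∈ unionBelow piece J → ∃ λ j → j < J × v ∈ U × β v ≡ j
      below v∈ = let (j , j<J , v∈j) = ∈-unionBelow⁻ piece J v∈ ; (v∈U , v∈L) = x∈p∩q⁻ U _ v∈j in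
        j , j<J , v∈U , ∈-layerSet⁻ {ℓ = β} v∈L
      at : ∀ {v} → v ∈ piece J → v ∈ U × β v ≡ J
      at v∈ = let (v∈U , v∈L) = x∈p∩q⁻ U _ v∈ in v∈U , ∈-layerSet⁻ {ℓ = β} v∈L
      disjoint : Empty (unionBelow piece J ∩ piece J)
      disjoint (v , v∈) =
        let (v∈below , v∈J) = x∈p∩q⁻ (unionBelow piece J) _ v∈ ; (_ , j<J , _ , βv≡j) = below v∈below in
        <⇒≢ j<J (trans (sym βv≡j) (proj₂ (at v∈J)))
      separated : ∀ {u v} → u ∈ unionBelow piece J → v ∈ piece J → ¬ Adj G u v
      separated u∈ v∈ uv =
        let (_ , j<J , u∈U , βu≡j) = below u∈ ; (v∈U , βv≡J) = at v∈ in
        <⇒≢ j<J (trans (sym βu≡j) (trans (β-constant u∈U v∈U uv) βv≡J))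

LayerWidthAtMost : ∀ {n} {G : Graph n} {U} → TreeDecomp G U → (Fin n → ℕ) → ℕ → Set
LayerWidthAtMost D ℓ c = ∀ x i → ∣ bag D x ∩ layerSet ℓ i ∣ ≤ c

module _ {n} {G : Graph n} {ℓ : Fin n → ℕ} (layering : IsLayering G ℓ) where

  adjacent-layers : ∀ {u v} → Adj G u v → ℓ u ≡ ℓ v ⊎ ℓ v ≡ suc (ℓ u) ⊎ ℓ u ≡ suc (ℓ v)
  adjacent-layers {u} {v} uv with <-cmp (ℓ u) (ℓ v) | layering u v uv
  ... | tri< ℓu<ℓv _ _ | _ , ℓv≤1+ℓu = inj₂ (inj₁ (≤-antisym ℓv≤1+ℓu ℓu<ℓv))
  ... | tri≈ _ ℓu≡ℓv _ | _           = inj₁ ℓu≡ℓv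
  ... | tri> _ _ ℓv<ℓu | ℓu≤1+ℓv , _ = inj₂ (inj₂ (≤-antisym ℓu≤1+ℓv ℓv<ℓu))

  constant-across-edges : (P : ℕ → Set) (β : ℕ → ℕ) → (∀ {a} → P a → P (suc a) → β (suc a) ≡ β a) →
                          ∀ {u v} → P (ℓ u) → P (ℓ v) → Adj G u v → β (ℓ u) ≡ β (ℓ v)
  constant-across-edges P β β-step {u} {v} Pu Pv uv with adjacent-layers uv
  ... | inj₁ ℓu≡ℓv        = cong β ℓu≡ℓv
  ... | inj₂ (inj₁ ℓv≡1+ℓu) = sym (trans (cong β ℓv≡1+ℓu) (β-step Pu (subst P ℓv≡1+ℓu Pv)))
  ... | inj₂ (inj₂ ℓu≡1+ℓv) = trans (cong β ℓu≡1+ℓv) (β-step Pv (subst P ℓu≡1+ℓv Pu))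

  shift-isLayering : ∀ t → IsLayering G (λ v → ℓ v + t)
  shift-isLayering t u v uv = let (ℓu≤ , ℓv≤) = layering u v uv in +-monoˡ-≤ t ℓu≤ , +-monoˡ-≤ t ℓv≤

shift-layerWidth : ∀ {n} {G : Graph n} {U} {D : TreeDecomp G U} {ℓ c} t →
                   LayerWidthAtMost D ℓ c → LayerWidthAtMost D (λ v → ℓ v + t) c
shift-layerWidth {D = D} {ℓ} t width x i = ≤-trans (p⊆q⇒∣p∣≤∣q∣ shifted⊆) (width x (i ∸ t))
  where
  shifted⊆ : bag D x ∩ layerSet (λ v → ℓ v + t) i ⊆ bag D x ∩ layerSet ℓ (i ∸ t)
  shifted⊆ {v} v∈ = let (v∈x , v∈i) = x∈p∩q⁻ (bag D x) _ v∈ in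
    x∈p∩q⁺ (v∈x , ∈-layerSet⁺ {ℓ = ℓ} (trans (sym (m+n∸n≡m (ℓ v) t)) (cong (_∸ t) (∈-layerSet⁻ {ℓ = λ v → ℓ v + t} v∈i))))

subBags-layerWidth : ∀ {n} {G : Graph n} {U₀ U} {D₀ : TreeDecomp G U₀} {D : TreeDecomp G U} {ℓ c} →
                     (∀ z → ∃ λ x → bag D z ⊆ bag D₀ x) → LayerWidthAtMost D₀ ℓ c → LayerWidthAtMost D ℓ c
subBags-layerWidth {D = D} sub width z i =
  let (x , z⊆x) = sub z in
  ≤-trans (p⊆q⇒∣p∣≤∣q∣ (λ v∈ → let (v∈z , v∈i) = x∈p∩q⁻ (bag D z) _ v∈ in x∈p∩q⁺ (z⊆x v∈z , v∈i))) (width x i)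

unionBags-layers : ∀ {n} {G : Graph n} {U} {D : TreeDecomp G U} {ℓ c} → LayerWidthAtMost D ℓ c →
                   ∀ {k} (f : Fin k → Node (tree D)) i → ∣ unionBags D f ∩ layerSet ℓ i ∣ ≤ k * c
unionBags-layers {D = D} width {k} f i = ∣⋃∩p∣≤k*c k (bag D ∘ f) _ (λ j → width (f j) i)

pathTree : ℕ → Tree
pathTree M = record { m = M ; parent = inject₁ ; parent≤ = ≤-reflexive ∘ toℕ-inject₁ }

pathTree-TAdj : ∀ {M} {x y : Fin (suc M)} → toℕ y ≡ suc (toℕ x) → TAdj (pathTree M) x y × TAdj (pathTree M) y x
pathTree-TAdj {x = x} {suc i} y≡1+x = inj₂ (i , refl , x≡i) , inj₁ (i , refl , x≡i)
  where
  x≡i : x ≡ inject₁ i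
  x≡i = toℕ-injective (trans (sym (suc-injective y≡1+x)) (sym (toℕ-inject₁ i)))

module _ {n} {G : Graph n} {ℓ : Fin n → ℕ} (layering : IsLayering G ℓ) (U : Subset n) where
  private
    B = proj₁ (bounded ℓ)

  pathBag : Fin (suc B) → Subset n
  pathBag z = U ∩ (layerSet ℓ (toℕ z) ∪ layerSet ℓ (suc (toℕ z)))

  private
    ∈-pathBag⁺ : ∀ {v z} → v ∈ U → ℓ v ≡ toℕ z ⊎ ℓ v ≡ suc (toℕ z) → v ∈ pathBag z
    ∈-pathBag⁺ v∈U (inj₁ ℓv≡z)   = x∈p∩q⁺ (v∈U , x∈p∪q⁺ (inj₁ (∈-layerSet⁺ {ℓ = ℓ} ℓv≡z)))
    ∈-pathBag⁺ v∈U (inj₂ ℓv≡1+z) = x∈p∩q⁺ (v∈U , x∈p∪q⁺ (inj₂ (∈-layerSet⁺ {ℓ = ℓ} ℓv≡1+z)))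

    ∈-pathBag⁻ : ∀ {v z} → v ∈ pathBag z → v ∈ U × (ℓ v ≡ toℕ z ⊎ ℓ v ≡ suc (toℕ z))
    ∈-pathBag⁻ {z = z} v∈ with x∈p∩q⁻ U _ v∈
    ... | v∈U , v∈layers with x∈p∪q⁻ (layerSet ℓ (toℕ z)) _ v∈layers
    ... | inj₁ v∈z   = v∈U , inj₁ (∈-layerSet⁻ {ℓ = ℓ} v∈z)
    ... | inj₂ v∈1+z = v∈U , inj₂ (∈-layerSet⁻ {ℓ = ℓ} v∈1+z)

    layerNode : Fin n → Fin (suc B)
    layerNode v = fromℕ< (m<n⇒m<1+n (proj₂ (bounded ℓ) v))

    ℓ≡layerNode : ∀ v → ℓ v ≡ toℕ (layerNode v)
    ℓ≡layerNode v = sym (toℕ-fromℕ< _)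

    pathEdge : ∀ u v → u ∈ U → v ∈ U → Adj G u v → ∃ λ z → u ∈ pathBag z × v ∈ pathBag z
    pathEdge u v u∈U v∈U uv with adjacent-layers {G = G} {ℓ = ℓ} layering uv
    ... | inj₁ ℓu≡ℓv          = layerNode u , ∈-pathBag⁺ u∈U (inj₁ (ℓ≡layerNode u)) ,
                                ∈-pathBag⁺ v∈U (inj₁ (trans (sym ℓu≡ℓv) (ℓ≡layerNode u)))
    ... | inj₂ (inj₁ ℓv≡1+ℓu) = layerNode u , ∈-pathBag⁺ u∈U (inj₁ (ℓ≡layerNode u)) ,
                                ∈-pathBag⁺ v∈U (inj₂ (trans ℓv≡1+ℓu (cong suc (ℓ≡layerNode u))))
    ... | inj₂ (inj₂ ℓu≡1+ℓv) = layerNode v , ∈-pathBag⁺ u∈U (inj₂ (trans ℓu≡1+ℓv (cong suc (ℓ≡layerNode v)))) ,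
                                ∈-pathBag⁺ v∈U (inj₁ (ℓ≡layerNode v))

    pathConn : ∀ v → Connected (λ z → v ∈ pathBag z) (TAdj (pathTree B))
    pathConn v x y v∈x v∈y with proj₂ (∈-pathBag⁻ v∈x) | proj₂ (∈-pathBag⁻ v∈y)
    ... | inj₁ ℓv≡x   | inj₁ ℓv≡y   = subst (Walk _ _ x) (toℕ-injective (trans (sym ℓv≡x) ℓv≡y)) (here v∈x)
    ... | inj₂ ℓv≡1+x | inj₂ ℓv≡1+y = subst (Walk _ _ x) (toℕ-injective (suc-injective (trans (sym ℓv≡1+x) ℓv≡1+y))) (here v∈x)
    ... | inj₁ ℓv≡x   | inj₂ ℓv≡1+y = step v∈x (proj₂ (pathTree-TAdj (trans (sym ℓv≡x) ℓv≡1+y))) (here v∈y)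
    ... | inj₂ ℓv≡1+x | inj₁ ℓv≡y   = step v∈x (proj₁ (pathTree-TAdj (trans (sym ℓv≡y) ℓv≡1+x))) (here v∈y)

  layerPathDecomp : TreeDecomp G U
  layerPathDecomp = record
    { tree   = pathTree B
    ; bag    = pathBag
    ; bag⊆U  = λ _ _ → proj₁ ∘ ∈-pathBag⁻
    ; vertex = λ v v∈U → layerNode v , ∈-pathBag⁺ v∈U (inj₁ (ℓ≡layerNode v))
    ; edge   = pathEdge
    ; conn   = pathConn
    }

  layerPathDecomp-pw : ∀ {K} → (∀ i → ∣ U ∩ layerSet ℓ i ∣ ≤ K) → PwAtMost G U (2 * K ∸ 1)
  layerPathDecomp-pw {K} layer≤ = layerPathDecomp , toℕ-inject₁ , λ z → begin
    ∣ U ∩ (layerSet ℓ (toℕ z) ∪ layerSet ℓ (suc (toℕ z))) ∣              ≡⟨ cong ∣_∣ (∩-distribˡ-∪ U _ _) ⟩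
    ∣ U ∩ layerSet ℓ (toℕ z) ∪ U ∩ layerSet ℓ (suc (toℕ z)) ∣           ≤⟨ ∣p∪q∣≤∣p∣+∣q∣ (U ∩ layerSet ℓ (toℕ z)) _ ⟩
    ∣ U ∩ layerSet ℓ (toℕ z) ∣ + ∣ U ∩ layerSet ℓ (suc (toℕ z)) ∣       ≤⟨ +-mono-≤ (layer≤ _) (layer≤ _) ⟩
    K + K                                                              ≡⟨ cong (K +_) (+-identityʳ K) ⟨
    2 * K                                                              ≤⟨ m≤n+m∸n (2 * K) 1 ⟩
    suc (2 * K ∸ 1)                                                    ∎
    where open ≤-Reasoning

module _ {n} {G : Graph n} {c} (D : TreeDecomp G Subset.⊤) {ℓ : Fin n → ℕ}
         (layering : IsLayering G ℓ) (width : LayerWidthAtMost D ℓ c) where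

  multiples-tw : ∀ {σ} → 1 < σ → TwAtMost G (multiples σ ℓ) (c ∸ 1)
  multiples-tw {σ} 1<σ =
    let (D₁ , fibred) = fibredDecomp D ℓ (λ _ → ∈⊤) same-layer in
    D₁ , λ z → let (x , j , z⊆) = fibred z in ≤-trans (p⊆q⇒∣p∣≤∣q∣ z⊆) (≤-trans (width x j) (m≤n+m∸n c 1))
    where
    same-layer : ∀ {u v} → u ∈ multiples σ ℓ → v ∈ multiples σ ℓ → Adj G u v → ℓ u ≡ ℓ v
    same-layer u∈ v∈ = constant-across-edges {G = G} {ℓ = ℓ} layering (σ ∣_) (λ a → a)
      (λ σ∣a σ∣1+a → contradiction σ∣1+a (∣m⇒∤[1+m] 1<σ σ∣a)) (∈-multiples⁻ u∈) (∈-multiples⁻ v∈)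

  nonMultiples-decomp : ∀ p → Σ (TreeDecomp G (∁ (multiples (suc p) ℓ))) λ D₂ →
                        BagsAtMost D₂ (p * c) × LayerWidthAtMost D₂ ℓ c
  nonMultiples-decomp p =
    let (D₂ , fibred) = fibredDecomp D block (λ _ → ∈⊤) same-block in
    D₂ , (λ z → let (x , j , z⊆) = fibred z in
                interval⇒∣q∣≤d*c ℓ (width x) p (suc (j * σ)) (proj₁ ∘ x∈p∩q⁻ _ _ ∘ z⊆) (in-block D₂ z⊆))
       , subBags-layerWidth {D₀ = D} {D = D₂} {ℓ = ℓ} (λ z → let (x , _ , z⊆) = fibred z in x , proj₁ ∘ x∈p∩q⁻ _ _ ∘ z⊆) width
    where
    σ = suc p
    S = multiples σ ℓ
    block : Fin n → ℕ
    block v = ℓ v / σ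

    ∉S⇒∤ : ∀ {v} → v ∈ ∁ S → ¬ σ ∣ ℓ v
    ∉S⇒∤ v∈ σ∣ℓv = x∈∁p⇒x∉p v∈ (∈-multiples⁺ {f = ℓ} σ∣ℓv)

    same-block : ∀ {u v} → u ∈ ∁ S → v ∈ ∁ S → Adj G u v → block u ≡ block v
    same-block u∈ v∈ = constant-across-edges {G = G} {ℓ = ℓ} layering (λ a → ¬ σ ∣ a) (_/ σ)
      (λ _ σ∤1+a → ∤[1+m]⇒[1+m]/n≡m/n σ∤1+a) (∉S⇒∤ u∈) (∉S⇒∤ v∈)

    in-block : ∀ (D₂ : TreeDecomp G (∁ S)) {z x j} → bag D₂ z ⊆ bag D x ∩ layerSet block j →
               ∀ {v} → v ∈ bag D₂ z → suc (j * σ) ≤ ℓ v × ℓ v < suc (j * σ) + p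
    in-block D₂ {z} {j = j} z⊆ {v} v∈ =
      let block≡j = ∈-layerSet⁻ {ℓ = block} (proj₂ (x∈p∩q⁻ _ _ (z⊆ v∈)))
          σ∤ℓv    = ∉S⇒∤ (bag⊆U D₂ z v v∈)
      in subst (λ b → b * σ < ℓ v) block≡j (∤⇒[m/n]*n<m σ∤ℓv)
       , subst (λ b → ℓ v < suc b) (+-comm p (j * σ)) (subst (λ b → ℓ v < suc b * σ) block≡j (m<[1+m/n]*n (ℓ v)))

least-period : ∀ n c x → n ≤ c * (suc (suc x) * suc (suc x)) →
              ∃ λ q → n ≤ c * (suc (suc q) * suc (suc q)) × (q ≡ 0 ⊎ c * (suc q * suc q) < n)
least-period n c zero    n≤ = 0 , n≤ , inj₁ refl
least-period n c (suc x) n≤ with n ≤? c * (suc (suc x) * suc (suc x))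
... | yes n≤smaller = least-period n c x n≤smaller
... | no n≰smaller  = suc x , n≤ , inj₂ (≰⇒> n≰smaller)

[a*c]*[a*c]≡c*[c*[a*a]] : ∀ a c → (a * c) * (a * c) ≡ c * (c * (a * a))
[a*c]*[a*c]≡c*[c*[a*a]] = solve-∀

-- For σ = 2 the block bound (σ − 1)c may exceed √(cn); the trivial bound n then takes over.
choose-period : ∀ n c → 1 ≤ c → ∃ λ q → n ≤ c * (suc (suc q) * suc (suc q)) × (n ⊓ (suc q * c)) * (n ⊓ (suc q * c)) ≤ c * n
choose-period n c 1≤c with least-period n c n (n≤c*[2+n]² c 1≤c)
  where
  n≤c*[2+n]² : ∀ c → 1 ≤ c → n ≤ c * (suc (suc n) * suc (suc n))
  n≤c*[2+n]² c@(suc _) _ = ≤-trans (≤-trans (n≤1+n n) (n≤1+n (suc n))) (≤-trans (m≤m*n _ (suc (suc n))) (m≤n*m _ c))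
... | q , n≤ , inj₁ refl = 0 , n≤ ,
      ≤-trans (*-mono-≤ (m⊓n≤n n (1 * c)) (m⊓n≤m n (1 * c))) (≤-reflexive (cong (_* n) (*-identityˡ c)))
... | q , n≤ , inj₂ c[1+q]²<n = q , n≤ , (begin
  (n ⊓ (suc q * c)) * (n ⊓ (suc q * c))   ≤⟨ *-mono-≤ (m⊓n≤n n _) (m⊓n≤n n _) ⟩
  (suc q * c) * (suc q * c)               ≡⟨ [a*c]*[a*c]≡c*[c*[a*a]] (suc q) c ⟩
  c * (c * (suc q * suc q))               ≤⟨ *-monoʳ-≤ c (<⇒≤ c[1+q]²<n) ⟩
  c * n                                   ∎)
  where open ≤-Reasoning

sparse-square : ∀ {σ s n c} .{{_ : NonZero σ}} → σ * s ≤ n → n ≤ c * (σ * σ) → s * s ≤ c * n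
sparse-square {σ} {s} {n} {c} σs≤n n≤cσ² = *-cancelˡ-≤ (σ * σ) {{m*n≢0 σ σ}} (begin
  (σ * σ) * (s * s)      ≡⟨ [m*n]*[o*p]≡[m*o]*[n*p] σ σ s s ⟩
  (σ * s) * (σ * s)      ≤⟨ *-mono-≤ σs≤n σs≤n ⟩
  n * n                  ≤⟨ *-monoʳ-≤ n n≤cσ² ⟩
  n * (c * (σ * σ))      ≡⟨ rearrange n c (σ * σ) ⟩
  (σ * σ) * (c * n)      ∎)
  where
  open ≤-Reasoning
  rearrange : ∀ n c a → n * (c * a) ≡ a * (c * n)
  rearrange = solve-∀

lemma31 : ∀ {n : ℕ} (G : Graph n) (c : ℕ) → 1 ≤ c → LayeredTreewidth G c →
    Σ (Subset n) λ S →
      (∣ S ∣ * ∣ S ∣ ≤ c * n)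
      × TwAtMost G S (c ∸ 1)
      × Σ (TreeDecomp G (∁ S)) λ D →
          (∃ λ w → w * w ≤ c * n × BagsAtMost D (suc w))
          × (∀ (k : ℕ) → 1 ≤ k → (f : Fin k → Node (tree D)) → Injective _≡_ _≡_ f →
               PwAtMost G (unionBags D f) (2 * c * k ∸ 1))
lemma31 {n} G c 1≤c ((D , ℓ₀ , layering₀ , width₀) , _) =
  let (q , n≤cσ² , b²≤cn) = choose-period n c 1≤c
      (t , σ∣S∣≤n)          = sparse-shift ℓ₀ (suc q)
      layering              = shift-isLayering {G = G} layering₀ t
      width                 = shift-layerWidth {D = D} {ℓ = ℓ₀} t width₀
      (D₂ , bags₂ , width₂) = nonMultiples-decomp D layering width (suc q)
      S                     = multiples (suc (suc q)) (λ v → ℓ₀ v + t)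
      b                     = n ⊓ (suc q * c)
  in S
   , sparse-square {s = ∣ S ∣} {c = c} σ∣S∣≤n n≤cσ²
   , multiples-tw D layering width (s≤s (s≤s z≤n))
   , D₂
   , (b ∸ 1 , ≤-trans (*-mono-≤ (m∸n≤m b 1) (m∸n≤m b 1)) b²≤cn
            , λ z → ≤-trans (⊓-glb (∣p∣≤n (bag D₂ z)) (bags₂ z)) (m≤n+m∸n b 1))
   , λ k _ f _ → subst (λ K → PwAtMost G (unionBags D₂ f) (K ∸ 1))
                       (trans (cong (2 *_) (*-comm k c)) (sym (*-assoc 2 c k)))
                       (layerPathDecomp-pw layering (unionBags D₂ f) (unionBags-layers {D = D₂} {ℓ = λ v → ℓ₀ v + t} width₂ f))
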